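{- In the stochastic unbounded min-knapsack problem described in the context, let $OPT^{(b)}_W$ be the minimum expected cost of a block strategy. Then \[OPT_W\le OPT^{(b)}_W\le OPT_W+\frac{\epsilon T}{5}.\]
   Context: Fix integers $n\ge1$, $W\ge1$ and $\epsilon\in(0,1)$. There are $n$ item types; type $i$ has a deterministic cost $c_i>0$ and a random weight $X_i$ with known distribution supported in $\{1,\dots,W\}$ (standing assumption). Infinitely many items of each type, all weights independent; items are inserted one at a time with weights revealed upon insertion, and a strategy adaptively chooses what to insert until the total weight is at least $W$. $OPT_W$ denotes the minimum expected total cost over all strategies (equivalently $OPT_w=0$ for $w\le 0$ and $OPT_w=\min_j(c_j+\sum_{k=1}^W\Pr[X_j=k]OPT_{w-k})$ for $1\le w\le W$). Let $\bar E[X_i]=\sum_{j=1}^W\Pr[X_i=j]2^{\lfloor\log_2j\rfloor}$, $T=\frac W2\min_i\frac{c_i}{\bar E[X_i]}$ and $\theta=\frac{\epsilon}{10n}$. For each type $p$: if $c_p\ge\theta T$ let $e_p=1$; otherwise let $e_p=2^{k_p}$ for an integer $k_p$ such that $e_pc_p\in[\theta T,2\theta T]$. A block strategy is a strategy in which, for every type $p$, items of type $p$ are always inserted a multiple of $e_p$ at a time, all together (no decision is taken between the items of such a group; the group is completed even if the total weight reaches $W$ in the middle of it).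
   Formalization: The costs $c_i$, the weight probabilities $\Pr[X_i=j]$ and the parameter ε take rational values. -}

module Defs where

open import Data.Nat as ℕ using (ℕ; zero; suc; _∸_; _^_)
open import Data.Nat.Logarithm using (⌊log₂_⌋)
open import Data.Integer using (+_)
open import Data.Fin using (Fin; toℕ) renaming (zero to fzero; suc to fsuc)
open import Data.List using (List; []; _∷_; _++_)
open import Data.Product using (_×_; _,_; Σ; ∃)
open import Data.Rational using (ℚ; 0ℚ; 1ℚ; _+_; _*_; _÷_; _⊓_; _≤_; _<_; _/_; ≢-nonZero)
open import Data.Rational.Properties using (_≟_)
open import Relation.Nullary using (yes; no)
open import Relation.Binary.PropositionalEquality using (_≡_)

ℕ→ℚ : ℕ → ℚ
ℕ→ℚ m = + m / 1

-- total division (returns 0 when dividing by 0; only used with positive divisors)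
_div_ : ℚ → ℚ → ℚ
p div q with q ≟ 0ℚ
... | yes _ = 0ℚ
... | no q≢0 = _÷_ p q {{≢-nonZero q≢0}}

sumFin : ∀ {m} → (Fin m → ℚ) → ℚ
sumFin {zero} f = 0ℚ
sumFin {suc m} f = f fzero + sumFin (λ i → f (fsuc i))

-- minimum over Fin m (0 for the empty index set; only used with m ≥ 1)
minFin : ∀ {m} → (Fin m → ℚ) → ℚ
minFin {zero} f = 0ℚ
minFin {suc zero} f = f fzero
minFin {suc (suc m)} f = f fzero ⊓ minFin (λ i → f (fsuc i))

-- An instance of the stochastic unbounded min-knapsack problem.
-- n item types, capacity W; cost c i; weight distribution of type i:
-- P i k = Pr[X_i = toℕ k + 1]   for k : Fin W  (support {1,…,W}).

record Instance (n W : ℕ) : Set where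
  field
    c : Fin n → ℚ
    P : Fin n → Fin W → ℚ

module _ {n W : ℕ} (I : Instance n W) where
  open Instance I

  wt : Fin W → ℕ
  wt k = suc (toℕ k)

  Valid : Set
  Valid = (∀ i → 0ℚ < c i) × (∀ i k → 0ℚ ≤ P i k) × (∀ i → sumFin (P i) ≡ 1ℚ)

  -- OPT via the dynamic program  OPT_w = min_j (c_j + Σ_k Pr[X_j=k] OPT_{w-k}),
  -- OPT_w = 0 for w ≤ 0.  The first argument is fuel; w decreases by ≥ 1 per
  -- step, so fuel W is enough for OPT_W.
  optF : ℕ → ℕ → ℚ
  optF zero w = 0ℚ
  optF (suc f) zero = 0ℚ
  optF (suc f) (suc w) = minFin (λ j → c j + sumFin (λ k → P j k * optF f (suc w ∸ wt k)))

  OPT : ℚ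
  OPT = optF W W

  Ebar : Fin n → ℚ
  Ebar i = sumFin (λ k → P i k * ℕ→ℚ (2 ^ ⌊log₂ wt k ⌋))

  T : ℚ
  T = (ℕ→ℚ W div ℕ→ℚ 2) * minFin (λ i → c i div Ebar i)

  θ : ℚ → ℚ
  θ ε = ε div ℕ→ℚ (10 ℕ.* n)

  ValidBlockSizes : ℚ → (Fin n → ℕ) → Set
  ValidBlockSizes ε e = ∀ p →
      (θ ε * T ≤ c p → e p ≡ 1)
    × (c p < θ ε * T → ∃ λ k → (e p ≡ 2 ^ k)
                              × (θ ε * T ≤ ℕ→ℚ (e p) * c p)
                              × (ℕ→ℚ (e p) * c p ≤ ℕ→ℚ 2 * (θ ε * T)))

  -- History: the list of inserted items so far, each (type, revealed weight).
  History : Set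
  History = List (Fin n × ℕ)

  -- A block strategy (w.r.t. block sizes e): given the history, when a new
  -- decision is due it picks a type p and a number m, and then inserts
  -- (m+1)·e_p items of type p in one group (no decisions inside the group;
  -- the group is completed even if the weight reaches W inside it).
  BlockStrategy : Set
  BlockStrategy = History → Fin n × ℕ

  module _ (e : Fin n → ℕ) (σ : BlockStrategy) where
    -- expected cost from history h with residual weight w still to cover.
    -- fuel counts groups; each group has ≥ 1 item (e_p ≥ 1) of weight ≥ 1,
    -- so W groups suffice starting from residual W.
    mutual
      costS : ℕ → History → ℕ → ℚ
      costS zero h w = 0ℚ
      costS (suc f) h zero = 0ℚ
      costS (suc f) h (suc w) with σ h
      ... | (p , m) = group f p (suc m ℕ.* e p) h (suc w)

      group : ℕ → Fin n → ℕ → History → ℕ → ℚ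
      group f p zero h w = costS f h w
      group f p (suc r) h w =
        c p + sumFin (λ k → P p k * group f p r (h ++ ((p , wt k) ∷ [])) (w ∸ wt k))

    blockCost : ℚ
    blockCost = costS W [] W

{-# OPTIONS --safe #-}
-- A block strategy is in particular an adaptive strategy, so the dynamic program bounds its
-- expected cost from below by OPT.
--
-- For the upper bound, the block strategy runs an optimal policy of the dynamic program: when
-- the policy asks for an item of type j, a whole block of e_j such items is inserted; the policy
-- uses the first one, and the other e_j - 1 wait in a queue, with their weights revealed, until
-- the policy asks for type j again.  As the weights are independent, drawing a weight in advance
-- does not change the expected remaining cost of the policy, so the potential
-- (expected remaining cost of the policy) - (cost of the queued items)
-- decreases in expectation by exactly what the strategy pays for each item.  Queued items are
-- already in the knapsack, so the strategy stops no later than the policy, and the queues never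
-- hold more than e_p - 1 items of type p.  Hence the strategy pays at most
-- OPT + Σ_p c_p (e_p - 1) ≤ OPT + n · 2θT = OPT + εT/5.
module Submission where

open import Defs
open import Data.Nat as ℕ using (ℕ; zero; suc; _∸_)
import Data.Nat.Properties as ℕ
open import Data.Nat.ListAction using (sum)
open import Data.Nat.ListAction.Properties using (sum-++)
open import Data.Nat.Logarithm using (⌊log₂_⌋)
import Data.Nat.Coprimality as Coprime
import Data.Integer as ℤ
import Data.Integer.Properties as ℤ
open import Data.Fin using (Fin; toℕ) renaming (zero to fzero; suc to fsuc)
open import Data.Fin.Properties using () renaming (_≟_ to _≟ᶠ_)
open import Data.List using (List; []; _∷_; _++_; length; map; foldl)
import Data.List.Properties as List
open import Data.Vec using (Vec; []; _∷_; lookup; replicate; _[_]≔_)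
import Data.Vec.Properties as Vec
open import Data.Product using (_×_; _,_; ∃; proj₁; proj₂)
open import Data.Unit using (⊤; tt)
open import Data.Empty using (⊥-elim)
open import Data.Rational
open import Data.Rational.Properties
open import Data.Rational.Solver using (module +-*-Solver)
open import Function using (_∘_)
open import Relation.Binary.PropositionalEquality
open import Relation.Nullary using (Dec; yes; no)
open import Algebra.Properties.CommutativeSemigroup ℕ.+-commutativeSemigroup
  using () renaming (x∙yz≈y∙xz to ℕ-+-left-comm; xy∙z≈y∙xz to ℕ-+-exchange)
open +-*-Solver

sumFin-cong : ∀ {m} {f g : Fin m → ℚ} → (∀ i → f i ≡ g i) → sumFin f ≡ sumFin g
sumFin-cong {zero} f≡g = refl
sumFin-cong {suc m} f≡g = cong₂ _+_ (f≡g fzero) (sumFin-cong (λ i → f≡g (fsuc i)))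

sumFin-mono : ∀ {m} {f g : Fin m → ℚ} → (∀ i → f i ≤ g i) → sumFin f ≤ sumFin g
sumFin-mono {zero} f≤g = ≤-refl
sumFin-mono {suc m} f≤g = +-mono-≤ (f≤g fzero) (sumFin-mono (λ i → f≤g (fsuc i)))

sumFin-nonneg : ∀ {m} {f : Fin m → ℚ} → (∀ i → 0ℚ ≤ f i) → 0ℚ ≤ sumFin f
sumFin-nonneg {zero} f≥0 = ≤-refl
sumFin-nonneg {suc m} f≥0 = +-mono-≤ (f≥0 fzero) (sumFin-nonneg (λ i → f≥0 (fsuc i)))

sumFin-distrib-+ : ∀ {m} (f g : Fin m → ℚ) → sumFin (λ i → f i + g i) ≡ sumFin f + sumFin g
sumFin-distrib-+ {zero} f g = refl
sumFin-distrib-+ {suc m} f g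
  rewrite sumFin-distrib-+ (λ i → f (fsuc i)) (λ i → g (fsuc i)) =
  solve 4 (λ a b x y → (a :+ b) :+ (x :+ y) := (a :+ x) :+ (b :+ y)) refl
    (f fzero) (g fzero) (sumFin (λ i → f (fsuc i))) (sumFin (λ i → g (fsuc i)))

sumFin-*ˡ : ∀ {m} (a : ℚ) (f : Fin m → ℚ) → sumFin (λ i → a * f i) ≡ a * sumFin f
sumFin-*ˡ {zero} a f = sym (*-zeroʳ a)
sumFin-*ˡ {suc m} a f rewrite sumFin-*ˡ a (λ i → f (fsuc i)) = sym (*-distribˡ-+ a _ _)

sumFin-*ʳ : ∀ {m} (a : ℚ) (f : Fin m → ℚ) → sumFin (λ i → f i * a) ≡ sumFin f * a
sumFin-*ʳ a f = trans (sumFin-cong (λ i → *-comm (f i) a)) (trans (sumFin-*ˡ a f) (*-comm a _))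

sumFin-zero : ∀ m → sumFin {m} (λ _ → 0ℚ) ≡ 0ℚ
sumFin-zero zero = refl
sumFin-zero (suc m) = trans (+-identityˡ _) (sumFin-zero m)

sumFin-comm : ∀ {m l} (F : Fin m → Fin l → ℚ) →
  sumFin (λ i → sumFin (λ k → F i k)) ≡ sumFin (λ k → sumFin (λ i → F i k))
sumFin-comm {zero} {l} F = sym (sumFin-zero l)
sumFin-comm {suc m} F rewrite sumFin-comm (λ i k → F (fsuc i) k) =
  sym (sumFin-distrib-+ (λ k → F fzero k) (λ k → sumFin (λ i → F (fsuc i) k)))

expect : ∀ {m} → (Fin m → ℚ) → (Fin m → ℚ) → ℚ
expect P f = sumFin (λ k → P k * f k)

expect-comm : ∀ {m l} (P : Fin m → ℚ) (P′ : Fin l → ℚ) (F : Fin m → Fin l → ℚ) →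
  expect P (λ k → expect P′ (F k)) ≡ expect P′ (λ k′ → expect P (λ k → F k k′))
expect-comm P P′ F = begin
  sumFin (λ k → P k * sumFin (λ k′ → P′ k′ * F k k′))
    ≡⟨ sumFin-cong (λ k → sym (sumFin-*ˡ (P k) (λ k′ → P′ k′ * F k k′))) ⟩
  sumFin (λ k → sumFin (λ k′ → P k * (P′ k′ * F k k′)))
    ≡⟨ sumFin-comm (λ k k′ → P k * (P′ k′ * F k k′)) ⟩
  sumFin (λ k′ → sumFin (λ k → P k * (P′ k′ * F k k′)))
    ≡⟨ sumFin-cong (λ k′ → sumFin-cong (λ k → *-left-commute (P k) (P′ k′) (F k k′))) ⟩
  sumFin (λ k′ → sumFin (λ k → P′ k′ * (P k * F k k′)))
    ≡⟨ sumFin-cong (λ k′ → sumFin-*ˡ (P′ k′) (λ k → P k * F k k′)) ⟩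
  sumFin (λ k′ → P′ k′ * sumFin (λ k → P k * F k k′)) ∎
  where
  open ≡-Reasoning
  *-left-commute : ∀ x y z → x * (y * z) ≡ y * (x * z)
  *-left-commute = solve 3 (λ x y z → x :* (y :* z) := y :* (x :* z)) refl

module Distribution {m} {P : Fin m → ℚ} (P≥0 : ∀ k → 0ℚ ≤ P k) (ΣP≡1 : sumFin P ≡ 1ℚ) where

  expect-const : ∀ a → expect P (λ _ → a) ≡ a
  expect-const a = trans (sumFin-*ʳ a P) (trans (cong (_* a) ΣP≡1) (*-identityˡ a))

  expect-const-+ : ∀ a f → expect P (λ k → a + f k) ≡ a + expect P f
  expect-const-+ a f = begin
    sumFin (λ k → P k * (a + f k))         ≡⟨ sumFin-cong (λ k → *-distribˡ-+ (P k) a (f k)) ⟩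
    sumFin (λ k → P k * a + P k * f k)     ≡⟨ sumFin-distrib-+ (λ k → P k * a) (λ k → P k * f k) ⟩
    expect P (λ _ → a) + expect P f        ≡⟨ cong (_+ expect P f) (expect-const a) ⟩
    a + expect P f                         ∎
    where open ≡-Reasoning

  expect-mono : ∀ {f g} → (∀ k → f k ≤ g k) → expect P f ≤ expect P g
  expect-mono f≤g = sumFin-mono (λ k → *-monoˡ-≤-nonNeg (P k) {{nonNegative (P≥0 k)}} (f≤g k))

  expect-nonneg : ∀ {f} → (∀ k → 0ℚ ≤ f k) → 0ℚ ≤ expect P f
  expect-nonneg f≥0 = ≤-trans (≤-reflexive (sym (expect-const 0ℚ))) (expect-mono f≥0)

minFin-≤ : ∀ {m} (f : Fin m → ℚ) (i : Fin m) → minFin f ≤ f i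
minFin-≤ {suc zero} f fzero = ≤-refl
minFin-≤ {suc (suc m)} f fzero = p⊓q≤p (f fzero) _
minFin-≤ {suc (suc m)} f (fsuc i) = ≤-trans (p⊓q≤q (f fzero) _) (minFin-≤ (λ j → f (fsuc j)) i)

minFin-nonneg : ∀ {m} (f : Fin m → ℚ) → (∀ i → 0ℚ ≤ f i) → 0ℚ ≤ minFin f
minFin-nonneg {zero} f f≥0 = ≤-refl
minFin-nonneg {suc zero} f f≥0 = f≥0 fzero
minFin-nonneg {suc (suc m)} f f≥0 =
  ⊓-glb (f≥0 fzero) (minFin-nonneg (λ j → f (fsuc j)) (λ j → f≥0 (fsuc j)))

argmin : ∀ {m} → (Fin (suc m) → ℚ) → Fin (suc m)
argmin {zero} f = fzero
argmin {suc m} f with f fzero ≤? minFin (λ j → f (fsuc j))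
... | yes _ = fzero
... | no _ = fsuc (argmin (λ j → f (fsuc j)))

argmin-attains : ∀ {m} (f : Fin (suc m) → ℚ) → f (argmin f) ≤ minFin f
argmin-attains {zero} f = ≤-refl
argmin-attains {suc m} f with f fzero ≤? minFin (λ j → f (fsuc j))
... | yes f₀≤ = ≤-reflexive (sym (p≤q⇒p⊓q≡p f₀≤))
... | no f₀≰ = ≤-trans (argmin-attains (λ j → f (fsuc j)))
                       (≤-reflexive (sym (p≥q⇒p⊓q≡q (<⇒≤ (≰⇒> f₀≰)))))

ℕ→ℚ≡mkℚ : ∀ m → ℕ→ℚ m ≡ mkℚ (ℤ.+ m) 0 (Coprime.sym (Coprime.1-coprimeTo m))
ℕ→ℚ≡mkℚ m = ↥p/↧p≡p (mkℚ (ℤ.+ m) 0 (Coprime.sym (Coprime.1-coprimeTo m)))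

-- The right-hand side computes to the unnormalised fraction (1 * 1 + m * 1) / 1.
ℕ→ℚ-suc : ∀ m → ℕ→ℚ (suc m) ≡ 1ℚ + ℕ→ℚ m
ℕ→ℚ-suc m = trans (/-cong {p₁ = ℤ.+ suc m} {q₁ = 1} {p₂ = ℤ.+ 1 ℤ.* ℤ.+ 1 ℤ.+ ℤ.+ m ℤ.* ℤ.+ 1} {q₂ = 1}
                     (cong (ℤ._+_ (ℤ.+ 1)) (sym (ℤ.*-identityʳ (ℤ.+ m)))) refl)
                  (cong (λ x → 1ℚ + x) (sym (ℕ→ℚ≡mkℚ m)))

ℕ→ℚ-+ : ∀ m n → ℕ→ℚ (m ℕ.+ n) ≡ ℕ→ℚ m + ℕ→ℚ n
ℕ→ℚ-+ zero n = sym (+-identityˡ (ℕ→ℚ n))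
ℕ→ℚ-+ (suc m) n = begin
  ℕ→ℚ (suc (m ℕ.+ n))        ≡⟨ ℕ→ℚ-suc (m ℕ.+ n) ⟩
  1ℚ + ℕ→ℚ (m ℕ.+ n)         ≡⟨ cong (1ℚ +_) (ℕ→ℚ-+ m n) ⟩
  1ℚ + (ℕ→ℚ m + ℕ→ℚ n)       ≡⟨ sym (+-assoc 1ℚ (ℕ→ℚ m) (ℕ→ℚ n)) ⟩
  (1ℚ + ℕ→ℚ m) + ℕ→ℚ n       ≡⟨ cong (_+ ℕ→ℚ n) (sym (ℕ→ℚ-suc m)) ⟩
  ℕ→ℚ (suc m) + ℕ→ℚ n        ∎
  where open ≡-Reasoning

ℕ→ℚ-* : ∀ m n → ℕ→ℚ (m ℕ.* n) ≡ ℕ→ℚ m * ℕ→ℚ n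
ℕ→ℚ-* zero n = sym (*-zeroˡ (ℕ→ℚ n))
ℕ→ℚ-* (suc m) n = begin
  ℕ→ℚ (n ℕ.+ m ℕ.* n)        ≡⟨ ℕ→ℚ-+ n (m ℕ.* n) ⟩
  ℕ→ℚ n + ℕ→ℚ (m ℕ.* n)      ≡⟨ cong (ℕ→ℚ n +_) (ℕ→ℚ-* m n) ⟩
  ℕ→ℚ n + ℕ→ℚ m * ℕ→ℚ n      ≡⟨ solve 2 (λ a b → b :+ a :* b := (con 1ℚ :+ a) :* b) refl (ℕ→ℚ m) (ℕ→ℚ n) ⟩
  (1ℚ + ℕ→ℚ m) * ℕ→ℚ n       ≡⟨ cong (_* ℕ→ℚ n) (sym (ℕ→ℚ-suc m)) ⟩
  ℕ→ℚ (suc m) * ℕ→ℚ n        ∎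
  where open ≡-Reasoning

ℕ→ℚ-nonneg : ∀ m → 0ℚ ≤ ℕ→ℚ m
ℕ→ℚ-nonneg m = nonNegative⁻¹ (ℕ→ℚ m) {{normalize-nonNeg m 1}}

ℕ→ℚ-mono : ∀ {m n} → m ℕ.≤ n → ℕ→ℚ m ≤ ℕ→ℚ n
ℕ→ℚ-mono {m} {n} m≤n = begin
  ℕ→ℚ m                   ≡⟨ sym (+-identityʳ _) ⟩
  ℕ→ℚ m + 0ℚ              ≤⟨ +-monoʳ-≤ (ℕ→ℚ m) (ℕ→ℚ-nonneg (n ∸ m)) ⟩
  ℕ→ℚ m + ℕ→ℚ (n ∸ m)   ≡⟨ sym (ℕ→ℚ-+ m (n ∸ m)) ⟩
  ℕ→ℚ (m ℕ.+ (n ∸ m))   ≡⟨ cong ℕ→ℚ (ℕ.m+[n∸m]≡n m≤n) ⟩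
  ℕ→ℚ n                   ∎
  where open ≤-Reasoning

ℕ→ℚ-suc≢0 : ∀ m → ℕ→ℚ (suc m) ≢ 0ℚ
ℕ→ℚ-suc≢0 m eq with cong ↥_ (trans (sym (ℕ→ℚ≡mkℚ (suc m))) eq)
... | ()

sumFin-const : ∀ m (x : ℚ) → sumFin {m} (λ _ → x) ≡ ℕ→ℚ m * x
sumFin-const zero x = sym (*-zeroˡ x)
sumFin-const (suc m) x = begin
  x + sumFin {m} (λ _ → x)   ≡⟨ cong (x +_) (sumFin-const m x) ⟩
  x + ℕ→ℚ m * x              ≡⟨ solve 2 (λ a b → b :+ a :* b := (con 1ℚ :+ a) :* b) refl (ℕ→ℚ m) x ⟩
  (1ℚ + ℕ→ℚ m) * x           ≡⟨ cong (_* x) (sym (ℕ→ℚ-suc m)) ⟩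
  ℕ→ℚ (suc m) * x            ∎
  where open ≡-Reasoning

*-nonneg : ∀ {p q} → 0ℚ ≤ p → 0ℚ ≤ q → 0ℚ ≤ p * q
*-nonneg {p} {q} p≥0 q≥0 =
  nonNegative⁻¹ (p * q) {{nonNeg*nonNeg⇒nonNeg p {{nonNegative p≥0}} q {{nonNegative q≥0}}}}

div-nonneg : ∀ {p q} → 0ℚ ≤ p → 0ℚ ≤ q → 0ℚ ≤ p div q
div-nonneg {p} {q} p≥0 q≥0 with q ≟ 0ℚ
... | yes _ = ≤-refl
... | no q≢0 = *-nonneg p≥0 (<⇒≤ (positive⁻¹ _ {{1/pos⇒pos q {{q>0}}}}))
  where
  q>0 : Positive q
  q>0 = nonNeg∧nonZero⇒pos q {{nonNegative q≥0}} {{≢-nonZero q≢0}}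

div≡*1/ : ∀ p q (q≢0 : q ≢ 0ℚ) → p div q ≡ p * (1/ q) {{≢-nonZero q≢0}}
div≡*1/ p q q≢0 with q ≟ 0ℚ
... | yes q≡0 = ⊥-elim (q≢0 q≡0)
... | no _ = refl

m≤1+n⇒m∸1+k≤n : ∀ {m n} k → m ℕ.≤ suc n → m ∸ suc k ℕ.≤ n
m≤1+n⇒m∸1+k≤n {zero} k _ = ℕ.z≤n
m≤1+n⇒m∸1+k≤n {suc m} k (ℕ.s≤s m≤n) = ℕ.≤-trans (ℕ.m∸n≤m m k) m≤n

m≤1+n∧1≤o⇒m≤n+o : ∀ {m n o} → m ℕ.≤ suc n → 1 ℕ.≤ o → m ℕ.≤ n ℕ.+ o
m≤1+n∧1≤o⇒m≤n+o {n = n} m≤1+n 1≤o =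
  ℕ.≤-trans m≤1+n (ℕ.≤-trans (ℕ.≤-reflexive (ℕ.+-comm 1 n)) (ℕ.+-monoʳ-≤ n 1≤o))

m≤n+1+o⇒m∸1+k≤n+o : ∀ {m n o} k → m ℕ.≤ n ℕ.+ suc o → m ∸ suc k ℕ.≤ n ℕ.+ o
m≤n+1+o⇒m∸1+k≤n+o {n = n} {o} k m≤ = m≤1+n⇒m∸1+k≤n k (ℕ.≤-trans m≤ (ℕ.≤-reflexive (ℕ.+-suc n o)))

∸-∸-comm : ∀ m n o → m ∸ n ∸ o ≡ m ∸ o ∸ n
∸-∸-comm m n o =
  trans (ℕ.∸-+-assoc m n o) (trans (cong (m ∸_) (ℕ.+-comm n o)) (sym (ℕ.∸-+-assoc m o n)))

-- An entry a of a queue stands for an item of weight suc a.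
Queues : ℕ → Set
Queues m = Vec (List ℕ) m

noQueues : ∀ m → Queues m
noQueues m = replicate m []

enqueue : ∀ {m} → Queues m → Fin m → ℕ → Queues m
enqueue Q j a = Q [ j ]≔ (lookup Q j ++ a ∷ [])

queuedCost : ∀ {m} → (Fin m → ℚ) → Queues m → ℚ
queuedCost c Q = sumFin (λ p → c p * ℕ→ℚ (length (lookup Q p)))

queuedWeight : ∀ {m} → Queues m → ℕ
queuedWeight [] = 0
queuedWeight (l ∷ Q) = sum (map suc l) ℕ.+ queuedWeight Q

lookup-enqueue : ∀ {m} (Q : Queues m) j a → lookup (enqueue Q j a) j ≡ lookup Q j ++ a ∷ []
lookup-enqueue Q j a = Vec.lookup∘update j Q _

lookup-enqueue-≢ : ∀ {m} (Q : Queues m) {i j} a → i ≢ j → lookup (enqueue Q j a) i ≡ lookup Q i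
lookup-enqueue-≢ Q a i≢j = Vec.lookup∘update′ i≢j Q _

length-enqueue : ∀ {m} (Q : Queues m) j a → length (lookup (enqueue Q j a) j) ≡ suc (length (lookup Q j))
length-enqueue Q j a = trans (cong length (lookup-enqueue Q j a))
                             (trans (List.length-++ (lookup Q j)) (ℕ.+-comm _ 1))

length-dequeue : ∀ {m} (Q : Queues m) j {a as} → lookup Q j ≡ a ∷ as →
  ∀ p → length (lookup (Q [ j ]≔ as) p) ℕ.≤ length (lookup Q p)
length-dequeue Q j {as = as} eq p with p ≟ᶠ j
... | yes refl rewrite Vec.lookup∘update p Q as | eq = ℕ.n≤1+n (length as)
... | no p≢j = ℕ.≤-reflexive (cong length (Vec.lookup∘update′ p≢j Q as))

enqueue-into-empty : ∀ {m} (Q : Queues m) j a → lookup Q j ≡ [] →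
  lookup (enqueue Q j a) j ≡ a ∷ [] × enqueue Q j a [ j ]≔ [] ≡ Q
enqueue-into-empty Q j a eq =
  trans (lookup-enqueue Q j a) (cong (_++ a ∷ []) eq) ,
  trans (Vec.[]≔-idempotent Q j) (trans (cong (Q [ j ]≔_) (sym eq)) (Vec.[]≔-lookup Q j))

enqueue-dequeue-comm : ∀ {m} (Q : Queues m) i j a {b bs} → lookup Q i ≡ b ∷ bs →
  ∃ λ bs′ → lookup (enqueue Q j a) i ≡ b ∷ bs′ × enqueue Q j a [ i ]≔ bs′ ≡ enqueue (Q [ i ]≔ bs) j a
enqueue-dequeue-comm Q i j a {bs = bs} eq with i ≟ᶠ j
... | yes refl = bs ++ a ∷ [] ,
  trans (lookup-enqueue Q i a) (cong (_++ a ∷ []) eq) ,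
  trans (Vec.[]≔-idempotent Q i)
        (sym (trans (cong (λ l → Q [ i ]≔ bs [ i ]≔ (l ++ a ∷ [])) (Vec.lookup∘update i Q bs))
                    (Vec.[]≔-idempotent Q i)))
... | no i≢j = bs ,
  trans (lookup-enqueue-≢ Q a i≢j) eq ,
  trans (Vec.[]≔-commutes Q j i (i≢j ∘ sym))
        (cong (λ l → Q [ i ]≔ bs [ j ]≔ (l ++ a ∷ [])) (sym (Vec.lookup∘update′ (i≢j ∘ sym) Q bs)))

private
  *-suc-+ : ∀ x n y → x * ℕ→ℚ (suc n) + y ≡ x + (x * ℕ→ℚ n + y)
  *-suc-+ x n y = trans (cong (λ k → x * k + y) (ℕ→ℚ-suc n))
    (solve 3 (λ x n y → x :* (con 1ℚ :+ n) :+ y := x :+ (x :* n :+ y)) refl x (ℕ→ℚ n) y)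

  +-left-comm : ∀ x y z → x + (y + z) ≡ y + (x + z)
  +-left-comm = solve 3 (λ x y z → x :+ (y :+ z) := y :+ (x :+ z)) refl

queuedCost-enqueue : ∀ {m} (c : Fin m → ℚ) Q j a → queuedCost c (enqueue Q j a) ≡ c j + queuedCost c Q
queuedCost-enqueue c (l ∷ Q) fzero a =
  trans (cong (λ k → c fzero * ℕ→ℚ k + queuedCost (c ∘ fsuc) Q) (length-enqueue (l ∷ Q) fzero a))
        (*-suc-+ (c fzero) (length l) (queuedCost (c ∘ fsuc) Q))
queuedCost-enqueue c (l ∷ Q) (fsuc j) a =
  trans (cong (c fzero * ℕ→ℚ (length l) +_) (queuedCost-enqueue (c ∘ fsuc) Q j a))
        (+-left-comm (c fzero * ℕ→ℚ (length l)) (c (fsuc j)) (queuedCost (c ∘ fsuc) Q))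

queuedCost-dequeue : ∀ {m} (c : Fin m → ℚ) Q j {a as} → lookup Q j ≡ a ∷ as →
  queuedCost c Q ≡ c j + queuedCost c (Q [ j ]≔ as)
queuedCost-dequeue c (.(_ ∷ as) ∷ Q) fzero {as = as} refl =
  *-suc-+ (c fzero) (length as) (queuedCost (c ∘ fsuc) Q)
queuedCost-dequeue c (l ∷ Q) (fsuc j) {as = as} eq =
  trans (cong (c fzero * ℕ→ℚ (length l) +_) (queuedCost-dequeue (c ∘ fsuc) Q j eq))
        (+-left-comm (c fzero * ℕ→ℚ (length l)) (c (fsuc j)) (queuedCost (c ∘ fsuc) (Q [ j ]≔ as)))

queuedCost-noQueues : ∀ {m} (c : Fin m → ℚ) → queuedCost c (noQueues m) ≡ 0ℚ
queuedCost-noQueues {zero} c = refl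
queuedCost-noQueues {suc m} c =
  trans (cong (_+ queuedCost (c ∘ fsuc) (noQueues m)) (*-zeroʳ (c fzero)))
        (trans (+-identityˡ _) (queuedCost-noQueues (c ∘ fsuc)))

queuedWeight-enqueue : ∀ {m} (Q : Queues m) j a → queuedWeight (enqueue Q j a) ≡ suc a ℕ.+ queuedWeight Q
queuedWeight-enqueue (l ∷ Q) fzero a
  rewrite List.map-++ suc l (a ∷ []) | sum-++ (map suc l) (suc a ∷ []) | ℕ.+-identityʳ (suc a) =
  ℕ-+-exchange (sum (map suc l)) (suc a) (queuedWeight Q)
queuedWeight-enqueue (l ∷ Q) (fsuc j) a
  rewrite queuedWeight-enqueue Q j a = ℕ-+-left-comm (sum (map suc l)) (suc a) (queuedWeight Q)

queuedWeight-dequeue : ∀ {m} (Q : Queues m) j {a as} → lookup Q j ≡ a ∷ as →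
  queuedWeight Q ≡ suc a ℕ.+ queuedWeight (Q [ j ]≔ as)
queuedWeight-dequeue (.(a ∷ as) ∷ Q) fzero {a} {as} refl = ℕ.+-assoc (suc a) (sum (map suc as)) _
queuedWeight-dequeue (l ∷ Q) (fsuc j) {a} eq
  rewrite queuedWeight-dequeue Q j eq = ℕ-+-left-comm (sum (map suc l)) (suc a) _

queuedWeight-noQueues : ∀ m → queuedWeight (noQueues m) ≡ 0
queuedWeight-noQueues zero = refl
queuedWeight-noQueues (suc m) = queuedWeight-noQueues m

leftoverCost : ∀ {m} → (Fin m → ℚ) → (Fin m → ℕ) → ℚ
leftoverCost c e = sumFin (λ p → c p * ℕ→ℚ (e p ∸ 1))

queuedCost≤leftoverCost : ∀ {m} (c : Fin m → ℚ) (e : Fin m → ℕ) Q → (∀ p → 0ℚ ≤ c p) →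
  (∀ p → length (lookup Q p) ℕ.≤ e p ∸ 1) → queuedCost c Q ≤ leftoverCost c e
queuedCost≤leftoverCost c e Q c≥0 short =
  sumFin-mono (λ p → *-monoˡ-≤-nonNeg (c p) {{nonNegative (c≥0 p)}} (ℕ→ℚ-mono (short p)))

module ValidInstance {n W : ℕ} (I : Instance n W) (V : Valid I) where
  open Instance I public

  c≥0 : ∀ p → 0ℚ ≤ c p
  c≥0 p = <⇒≤ (proj₁ V p)

  module Weight (p : Fin n) = Distribution (proj₁ (proj₂ V) p) (proj₂ (proj₂ V) p)

  optF-zero : ∀ F → optF I F 0 ≡ 0ℚ
  optF-zero zero = refl
  optF-zero (suc F) = refl

  costS-decision : ∀ e σ f h w {p m} → σ h ≡ (p , m) →
    costS I e σ (suc f) h (suc w) ≡ group I e σ f p (suc m ℕ.* e p) h (suc w)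
  costS-decision e σ f h w eq with σ h | eq
  ... | _ | refl = refl

module LowerBound {n W : ℕ} (I : Instance n W) (V : Valid I)
                  (e : Fin n → ℕ) (e≥1 : ∀ p → 1 ℕ.≤ e p) (σ : BlockStrategy I) where
  open ValidInstance I V

  mutual
    optF≤costS : ∀ F f h w → w ℕ.≤ f → optF I F w ≤ costS I e σ f h w
    optF≤costS F zero h zero _ = ≤-reflexive (optF-zero F)
    optF≤costS F zero h (suc w) ()
    optF≤costS F (suc f) h zero _ = ≤-reflexive (optF-zero F)
    optF≤costS F (suc f) h (suc w) w≤f with σ h
    ... | p , m = optF≤group F f p (suc m ℕ.* e p) h (suc w)
                    (m≤1+n∧1≤o⇒m≤n+o w≤f (ℕ.≤-trans (e≥1 p) (ℕ.m≤m+n (e p) _)))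

    optF≤group : ∀ F f p r h w → w ℕ.≤ f ℕ.+ r → optF I F w ≤ group I e σ f p r h w
    optF≤group F f p zero h w w≤f = optF≤costS F f h w (subst (w ℕ.≤_) (ℕ.+-identityʳ f) w≤f)
    optF≤group zero f p (suc r) h w w≤f = group-nonneg f p r h w w≤f
    optF≤group (suc F) f p (suc r) h zero w≤f = group-nonneg f p r h zero w≤f
    optF≤group (suc F) f p (suc r) h (suc w) w≤f = begin
      optF I (suc F) (suc w)
        ≤⟨ minFin-≤ _ p ⟩
      c p + expect (P p) (λ k → optF I F (suc w ∸ wt I k))
        ≤⟨ +-monoʳ-≤ (c p) (Weight.expect-mono p (λ k →
             optF≤group F f p r _ _ (m≤n+1+o⇒m∸1+k≤n+o (toℕ k) w≤f))) ⟩
      group I e σ f p (suc r) h (suc w) ∎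
      where open ≤-Reasoning

    group-nonneg : ∀ f p r h w → w ℕ.≤ f ℕ.+ suc r → 0ℚ ≤ group I e σ f p (suc r) h w
    group-nonneg f p r h w w≤f =
      +-mono-≤ (c≥0 p) (Weight.expect-nonneg p (λ k →
        optF≤group zero f p r _ _ (m≤n+1+o⇒m∸1+k≤n+o (toℕ k) w≤f)))

  OPT≤blockCost : OPT I ≤ blockCost I e σ
  OPT≤blockCost = optF≤costS W W [] W ℕ.≤-refl

module Simulation {N W : ℕ} (I : Instance (suc N) W) (V : Valid I) where
  open ValidInstance I V

  optChoice : ℕ → ℕ → Fin (suc N)
  optChoice g w = argmin (λ j → c j + expect (P j) (λ k → optF I g (w ∸ wt I k)))

  -- Expected cost of the optimal policy from residual weight w (fuel g, as in optF), where
  -- an item of a type with a nonempty queue is taken from the queue instead of being drawn.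
  mutual
    simCost : ℕ → ℕ → Queues (suc N) → ℚ
    simCost zero w Q = 0ℚ
    simCost (suc g) zero Q = 0ℚ
    simCost (suc g) w@(suc _) Q = simCostWith g w Q (optChoice g w) (lookup Q (optChoice g w))

    simCostWith : ℕ → ℕ → Queues (suc N) → Fin (suc N) → List ℕ → ℚ
    simCostWith g w Q j [] = c j + expect (P j) (λ k → simCost g (w ∸ wt I k) Q)
    simCostWith g w Q j (a ∷ as) = c j + simCost g (w ∸ suc a) (Q [ j ]≔ as)

  mutual
    simCost-nonneg : ∀ g w Q → 0ℚ ≤ simCost g w Q
    simCost-nonneg zero w Q = ≤-refl
    simCost-nonneg (suc g) zero Q = ≤-refl
    simCost-nonneg (suc g) w@(suc _) Q =
      simCostWith-nonneg g w Q (optChoice g w) (lookup Q (optChoice g w))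

    simCostWith-nonneg : ∀ g w Q j l → 0ℚ ≤ simCostWith g w Q j l
    simCostWith-nonneg g w Q j [] =
      +-mono-≤ (c≥0 j) (Weight.expect-nonneg j (λ k → simCost-nonneg g (w ∸ wt I k) Q))
    simCostWith-nonneg g w Q j (a ∷ as) = +-mono-≤ (c≥0 j) (simCost-nonneg g (w ∸ suc a) (Q [ j ]≔ as))

  simCost≤optF : ∀ g w Q → (∀ p → lookup Q p ≡ []) → simCost g w Q ≤ optF I g w
  simCost≤optF zero w Q empty = ≤-refl
  simCost≤optF (suc g) zero Q empty = ≤-refl
  simCost≤optF (suc g) w@(suc _) Q empty with lookup Q (optChoice g w) | empty (optChoice g w)
  ... | .[] | refl = begin
      c j + expect (P j) (λ k → simCost g (w ∸ wt I k) Q)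
        ≤⟨ +-monoʳ-≤ (c j) (Weight.expect-mono j (λ k → simCost≤optF g (w ∸ wt I k) Q empty)) ⟩
      c j + expect (P j) (λ k → optF I g (w ∸ wt I k))
        ≤⟨ argmin-attains (λ j → c j + expect (P j) (λ k → optF I g (w ∸ wt I k))) ⟩
      optF I (suc g) w ∎
    where
    open ≤-Reasoning
    j : Fin (suc N)
    j = optChoice g w

  EnqueueNeutral : ℕ → Fin (suc N) → Set
  EnqueueNeutral g j = ∀ w Q → expect (P j) (λ k → simCost g w (enqueue Q j (toℕ k))) ≡ simCost g w Q

  module _ (g w : ℕ) (Q : Queues (suc N)) (i : Fin (suc N)) where

    enqueue-behind : ∀ j {b bs} → lookup Q i ≡ b ∷ bs → EnqueueNeutral g j →
      expect (P j) (λ k → simCostWith g w (enqueue Q j (toℕ k)) i (lookup (enqueue Q j (toℕ k)) i))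
        ≡ simCostWith g w Q i (b ∷ bs)
    enqueue-behind j {b} {bs} eq neutral = begin
      expect (P j) (λ k → simCostWith g w (Q+ k) i (lookup (Q+ k) i))
        ≡⟨ sumFin-cong (λ k → cong (P j k *_) (pop-first (toℕ k))) ⟩
      expect (P j) (λ k → c i + simCost g (w ∸ suc b) (enqueue Q′ j (toℕ k)))
        ≡⟨ Weight.expect-const-+ j (c i) _ ⟩
      c i + expect (P j) (λ k → simCost g (w ∸ suc b) (enqueue Q′ j (toℕ k)))
        ≡⟨ cong (c i +_) (neutral (w ∸ suc b) Q′) ⟩
      c i + simCost g (w ∸ suc b) Q′ ∎
      where
      open ≡-Reasoning
      Q+ : Fin W → Queues (suc N)
      Q+ k = enqueue Q j (toℕ k)
      Q′ : Queues (suc N)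
      Q′ = Q [ i ]≔ bs
      pop-first : ∀ a → simCostWith g w (enqueue Q j a) i (lookup (enqueue Q j a) i)
                          ≡ c i + simCost g (w ∸ suc b) (enqueue Q′ j a)
      pop-first a with enqueue-dequeue-comm Q i j a eq
      ... | _ , lookup≡ , comm rewrite lookup≡ = cong (λ Q″ → c i + simCost g (w ∸ suc b) Q″) comm

    enqueue-consumed : lookup Q i ≡ [] →
      expect (P i) (λ k → simCostWith g w (enqueue Q i (toℕ k)) i (lookup (enqueue Q i (toℕ k)) i))
        ≡ simCostWith g w Q i []
    enqueue-consumed eq = trans (sumFin-cong (λ k → cong (P i k *_) (pop-new (toℕ k))))
                                (Weight.expect-const-+ i (c i) _)
      where
      pop-new : ∀ a → simCostWith g w (enqueue Q i a) i (lookup (enqueue Q i a) i)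
                        ≡ c i + simCost g (w ∸ suc a) Q
      pop-new a with enqueue-into-empty Q i a eq
      ... | lookup≡ , restore rewrite lookup≡ = cong (λ Q″ → c i + simCost g (w ∸ suc a) Q″) restore

    enqueue-elsewhere : ∀ j → i ≢ j → lookup Q i ≡ [] → EnqueueNeutral g j →
      expect (P j) (λ k → simCostWith g w (enqueue Q j (toℕ k)) i (lookup (enqueue Q j (toℕ k)) i))
        ≡ simCostWith g w Q i []
    enqueue-elsewhere j i≢j eq neutral = begin
      expect (P j) (λ k → simCostWith g w (Q+ k) i (lookup (Q+ k) i))
        ≡⟨ sumFin-cong (λ k → cong (P j k *_) (still-empty (toℕ k))) ⟩
      expect (P j) (λ k → c i + expect (P i) (λ k′ → simCost g (w ∸ wt I k′) (Q+ k)))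
        ≡⟨ Weight.expect-const-+ j (c i) _ ⟩
      c i + expect (P j) (λ k → expect (P i) (λ k′ → simCost g (w ∸ wt I k′) (Q+ k)))
        ≡⟨ cong (c i +_) (expect-comm (P j) (P i) (λ k k′ → simCost g (w ∸ wt I k′) (Q+ k))) ⟩
      c i + expect (P i) (λ k′ → expect (P j) (λ k → simCost g (w ∸ wt I k′) (Q+ k)))
        ≡⟨ cong (c i +_) (sumFin-cong (λ k′ → cong (P i k′ *_) (neutral (w ∸ wt I k′) Q))) ⟩
      c i + expect (P i) (λ k′ → simCost g (w ∸ wt I k′) Q) ∎
      where
      open ≡-Reasoning
      Q+ : Fin W → Queues (suc N)
      Q+ k = enqueue Q j (toℕ k)
      still-empty : ∀ a → simCostWith g w (enqueue Q j a) i (lookup (enqueue Q j a) i)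
                            ≡ simCostWith g w (enqueue Q j a) i []
      still-empty a = cong (simCostWith g w (enqueue Q j a) i) (trans (lookup-enqueue-≢ Q a i≢j) eq)

  enqueue-neutral : ∀ g j → EnqueueNeutral g j
  enqueue-neutral zero j w Q = Weight.expect-const j 0ℚ
  enqueue-neutral (suc g) j zero Q = Weight.expect-const j 0ℚ
  enqueue-neutral (suc g) j w@(suc _) Q with optChoice g w | lookup Q (optChoice g w) in eq
  ... | i | b ∷ bs = enqueue-behind g w Q i j eq (enqueue-neutral g j)
  ... | i | [] with i ≟ᶠ j
  ...   | yes refl = enqueue-consumed g w Q i eq
  ...   | no i≢j = enqueue-elsewhere g w Q i j i≢j eq (enqueue-neutral g j)

  record SimState : Set where
    constructor state
    field
      fuel residual : ℕ
      queues : Queues (suc N)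
  open SimState public

  mutual
    drain : ℕ → ℕ → Queues (suc N) → SimState
    drain zero w Q = state zero w Q
    drain (suc g) zero Q = state (suc g) zero Q
    drain (suc g) w@(suc _) Q = drainWith g w Q (lookup Q (optChoice g w))

    drainWith : ℕ → ℕ → Queues (suc N) → List ℕ → SimState
    drainWith g w Q [] = state (suc g) w Q
    drainWith g w Q (a ∷ as) = drain g (w ∸ suc a) (Q [ optChoice g w ]≔ as)

  potential : SimState → ℚ
  potential (state g w Q) = simCost g w Q - queuedCost c Q

  mutual
    potential-drain : ∀ g w Q → potential (drain g w Q) ≡ potential (state g w Q)
    potential-drain zero w Q = refl
    potential-drain (suc g) zero Q = refl
    potential-drain (suc g) (suc u) Q = potential-drainWith g u Q (lookup Q (optChoice g (suc u))) refl

    potential-drainWith : ∀ g u Q l → lookup Q (optChoice g (suc u)) ≡ l →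
      potential (drainWith g (suc u) Q l) ≡ simCostWith g (suc u) Q (optChoice g (suc u)) l - queuedCost c Q
    potential-drainWith g u Q [] eq =
      cong (λ l → simCostWith g (suc u) Q (optChoice g (suc u)) l - queuedCost c Q) eq
    potential-drainWith g u Q (a ∷ as) eq = begin
      potential (drain g w′ Q′)                ≡⟨ potential-drain g w′ Q′ ⟩
      simCost g w′ Q′ - queuedCost c Q′        ≡⟨ solve 3 (λ s x q → s :- q := (x :+ s) :- (x :+ q)) refl
                                                    (simCost g w′ Q′) (c j) (queuedCost c Q′) ⟩
      (c j + simCost g w′ Q′) - (c j + queuedCost c Q′)
                                              ≡⟨ cong (λ q → (c j + simCost g w′ Q′) - q) (sym (queuedCost-dequeue c Q j eq)) ⟩
      (c j + simCost g w′ Q′) - queuedCost c Q ∎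
      where
      open ≡-Reasoning
      j : Fin (suc N)
      j = optChoice g (suc u)
      w′ : ℕ
      w′ = suc u ∸ suc a
      Q′ : Queues (suc N)
      Q′ = Q [ j ]≔ as

  observe : SimState → Fin (suc N) × ℕ → SimState
  observe (state g w Q) (p , x) = drain g w (enqueue Q p (ℕ.pred x))

  potential-observe : ∀ s j → c j + expect (P j) (λ k → potential (observe s (j , wt I k))) ≡ potential s
  potential-observe (state g w Q) j = begin
    c j + expect (P j) (λ k → potential (drain g w (Q+ k)))
      ≡⟨ cong (c j +_) (sumFin-cong (λ k → cong (P j k *_) (potential-enqueue k))) ⟩
    c j + expect (P j) (λ k → - (c j + queuedCost c Q) + simCost g w (Q+ k))
      ≡⟨ cong (c j +_) (Weight.expect-const-+ j (- (c j + queuedCost c Q)) (λ k → simCost g w (Q+ k))) ⟩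
    c j + (- (c j + queuedCost c Q) + expect (P j) (λ k → simCost g w (Q+ k)))
      ≡⟨ cong (λ x → c j + (- (c j + queuedCost c Q) + x)) (enqueue-neutral g j w Q) ⟩
    c j + (- (c j + queuedCost c Q) + simCost g w Q)
      ≡⟨ solve 3 (λ x q s → x :+ (:- (x :+ q) :+ s) := s :- q) refl (c j) (queuedCost c Q) (simCost g w Q) ⟩
    simCost g w Q - queuedCost c Q ∎
    where
    open ≡-Reasoning
    Q+ : Fin W → Queues (suc N)
    Q+ k = enqueue Q j (toℕ k)
    potential-enqueue : ∀ k → potential (drain g w (Q+ k)) ≡ - (c j + queuedCost c Q) + simCost g w (Q+ k)
    potential-enqueue k = begin
      potential (drain g w (Q+ k))                ≡⟨ potential-drain g w (Q+ k) ⟩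
      simCost g w (Q+ k) - queuedCost c (Q+ k)    ≡⟨ cong (λ q → simCost g w (Q+ k) - q) (queuedCost-enqueue c Q j (toℕ k)) ⟩
      simCost g w (Q+ k) - (c j + queuedCost c Q) ≡⟨ +-comm (simCost g w (Q+ k)) _ ⟩
      - (c j + queuedCost c Q) + simCost g w (Q+ k) ∎

  Drained : SimState → Set
  Drained (state (suc g) w@(suc _) Q) = lookup Q (optChoice g w) ≡ []
  Drained _ = ⊤

  mutual
    drain-drained : ∀ g w Q → Drained (drain g w Q)
    drain-drained zero w Q = tt
    drain-drained (suc g) zero Q = tt
    drain-drained (suc g) w@(suc _) Q = drainWith-drained g w Q (lookup Q (optChoice g w)) refl

    drainWith-drained : ∀ g w Q l → lookup Q (optChoice g w) ≡ l → Drained (drainWith g w Q l)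
    drainWith-drained g zero Q [] eq = tt
    drainWith-drained g (suc u) Q [] eq = eq
    drainWith-drained g w Q (a ∷ as) eq = drain-drained g (w ∸ suc a) (Q [ optChoice g w ]≔ as)

  mutual
    drain-shortens : ∀ g w Q p → length (lookup (queues (drain g w Q)) p) ℕ.≤ length (lookup Q p)
    drain-shortens zero w Q p = ℕ.≤-refl
    drain-shortens (suc g) zero Q p = ℕ.≤-refl
    drain-shortens (suc g) w@(suc _) Q p = drainWith-shortens g w Q (lookup Q (optChoice g w)) refl p

    drainWith-shortens : ∀ g w Q l → lookup Q (optChoice g w) ≡ l →
      ∀ p → length (lookup (queues (drainWith g w Q l)) p) ℕ.≤ length (lookup Q p)
    drainWith-shortens g w Q [] eq p = ℕ.≤-refl
    drainWith-shortens g w Q (a ∷ as) eq p =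
      ℕ.≤-trans (drain-shortens g (w ∸ suc a) (Q [ optChoice g w ]≔ as) p)
                (length-dequeue Q (optChoice g w) eq p)

  -- w′ is the weight still missing in the real knapsack: items in the queues are already in it.
  Tracks : SimState → ℕ → Set
  Tracks s w′ = residual s ℕ.≤ fuel s × w′ ℕ.≤ residual s ∸ queuedWeight (queues s)

  mutual
    drain-tracks : ∀ g w Q w′ → w ℕ.≤ g → w′ ℕ.≤ w ∸ queuedWeight Q → Tracks (drain g w Q) w′
    drain-tracks zero w Q w′ w≤g w′≤ = w≤g , w′≤
    drain-tracks (suc g) zero Q w′ w≤g w′≤ = w≤g , w′≤
    drain-tracks (suc g) w@(suc _) Q w′ w≤g w′≤ =
      drainWith-tracks g w Q (lookup Q (optChoice g w)) refl w′ w≤g w′≤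

    drainWith-tracks : ∀ g w Q l → lookup Q (optChoice g w) ≡ l →
      ∀ w′ → w ℕ.≤ suc g → w′ ℕ.≤ w ∸ queuedWeight Q → Tracks (drainWith g w Q l) w′
    drainWith-tracks g w Q [] eq w′ w≤g w′≤ = w≤g , w′≤
    drainWith-tracks g w Q (a ∷ as) eq w′ w≤g w′≤ =
      drain-tracks g (w ∸ suc a) Q′ w′ (m≤1+n⇒m∸1+k≤n a w≤g)
        (subst (w′ ℕ.≤_) (trans (cong (w ∸_) (queuedWeight-dequeue Q (optChoice g w) eq))
                                (sym (ℕ.∸-+-assoc w (suc a) (queuedWeight Q′)))) w′≤)
      where Q′ = Q [ optChoice g w ]≔ as

  observe-first : ∀ g u Q a → Drained (state (suc g) (suc u) Q) →
    observe (state (suc g) (suc u) Q) (optChoice g (suc u) , suc a) ≡ drain g (suc u ∸ suc a) Q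
  observe-first g u Q a drained with enqueue-into-empty Q (optChoice g (suc u)) a drained
  ... | lookup≡ , restore rewrite lookup≡ = cong (drain g (u ∸ a)) restore

  initial : SimState
  initial = drain W W (noQueues (suc N))

  stateAfter : History I → SimState
  stateAfter = foldl observe initial

  stateAfter-snoc : ∀ h x → stateAfter (h ++ x ∷ []) ≡ observe (stateAfter h) x
  stateAfter-snoc h x = List.foldl-∷ʳ observe initial x h

  -- The second clause only applies once the real knapsack is full.
  nextChoice : SimState → Fin (suc N) × ℕ
  nextChoice (state (suc g) w@(suc _) Q) = optChoice g w , 0
  nextChoice _ = fzero , 0

  simulating : BlockStrategy I
  simulating h = nextChoice (stateAfter h)

  module Blocks (e : Fin (suc N) → ℕ) (e≥1 : ∀ p → 1 ℕ.≤ e p) where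

    ShortQueues : Queues (suc N) → Set
    ShortQueues Q = ∀ p → length (lookup Q p) ℕ.≤ e p ∸ 1

    record Invariant (s : SimState) (w′ : ℕ) : Set where
      field
        tracks : Tracks s w′
        short : ShortQueues (queues s)
        drained : Drained s
    open Invariant

    -- r items of type j are still to be inserted in the current group.
    InGroup : ℕ → Fin (suc N) → SimState → ℕ → Set
    InGroup r j s w′ = Invariant s w′ × length (lookup (queues s) j) ℕ.+ r ℕ.≤ e j ∸ 1

    drain-invariant : ∀ g w Q w′ → w ℕ.≤ g → w′ ℕ.≤ w ∸ queuedWeight Q → ShortQueues Q →
      Invariant (drain g w Q) w′
    drain-invariant g w Q w′ w≤g w′≤ short = record
      { tracks = drain-tracks g w Q w′ w≤g w′≤
      ; short = λ p → ℕ.≤-trans (drain-shortens g w Q p) (short p)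
      ; drained = drain-drained g w Q
      }

    potential+leftoverCost-nonneg : ∀ s → ShortQueues (queues s) → 0ℚ ≤ potential s + leftoverCost c e
    potential+leftoverCost-nonneg (state g w Q) short = begin
      0ℚ                                         ≤⟨ simCost-nonneg g w Q ⟩
      simCost g w Q                              ≡⟨ solve 2 (λ s q → s := (s :- q) :+ q) refl (simCost g w Q) (queuedCost c Q) ⟩
      (simCost g w Q - queuedCost c Q) + queuedCost c Q
                                                 ≤⟨ +-monoʳ-≤ (simCost g w Q - queuedCost c Q)
                                                      (queuedCost≤leftoverCost c e Q c≥0 short) ⟩
      (simCost g w Q - queuedCost c Q) + leftoverCost c e ∎
      where open ≤-Reasoning

    insert-≤ : ∀ s j (G : Fin W → ℚ) →
      (∀ k → G k ≤ potential (observe s (j , wt I k)) + leftoverCost c e) →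
      c j + expect (P j) G ≤ potential s + leftoverCost c e
    insert-≤ s j G G≤ = begin
      c j + expect (P j) G
        ≤⟨ +-monoʳ-≤ (c j) (Weight.expect-mono j (λ k → ≤-trans (G≤ k) (≤-reflexive (+-comm (Ψ′ k) L)))) ⟩
      c j + expect (P j) (λ k → L + Ψ′ k)  ≡⟨ cong (c j +_) (Weight.expect-const-+ j L Ψ′) ⟩
      c j + (L + expect (P j) Ψ′)          ≡⟨ solve 3 (λ x l y → x :+ (l :+ y) := (x :+ y) :+ l) refl (c j) L (expect (P j) Ψ′) ⟩
      (c j + expect (P j) Ψ′) + L          ≡⟨ cong (_+ L) (potential-observe s j) ⟩
      potential s + L                      ∎
      where
      open ≤-Reasoning
      L : ℚ
      L = leftoverCost c e
      Ψ′ : Fin W → ℚ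
      Ψ′ k = potential (observe s (j , wt I k))

    enqueue-short : ∀ Q j a → ShortQueues Q → suc (length (lookup Q j)) ℕ.≤ e j ∸ 1 →
      ShortQueues (enqueue Q j a)
    enqueue-short Q j a short room p with p ≟ᶠ j
    ... | yes refl = subst (ℕ._≤ e p ∸ 1) (sym (length-enqueue Q p a)) room
    ... | no p≢j = subst (ℕ._≤ e p ∸ 1) (sym (cong length (lookup-enqueue-≢ Q a p≢j))) (short p)

    inGroup-observe : ∀ {r j s w′} a → InGroup (suc r) j s w′ →
      InGroup r j (observe s (j , suc a)) (w′ ∸ suc a)
    inGroup-observe {r} {j} {state g w Q} {w′} a (inv , room) =
      drain-invariant g w Q+ (w′ ∸ suc a) (proj₁ (tracks inv)) tracked
        (enqueue-short Q j a (short inv) (ℕ.≤-trans (ℕ.s≤s (ℕ.m≤m+n _ r)) room′)) ,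
      ℕ.≤-trans (ℕ.+-monoˡ-≤ r (drain-shortens g w Q+ j))
                (subst (λ l → l ℕ.+ r ℕ.≤ e j ∸ 1) (sym (length-enqueue Q j a)) room′)
      where
      Q+ : Queues (suc N)
      Q+ = enqueue Q j a
      room′ : suc (length (lookup Q j) ℕ.+ r) ℕ.≤ e j ∸ 1
      room′ = subst (ℕ._≤ e j ∸ 1) (ℕ.+-suc _ r) room
      tracked : w′ ∸ suc a ℕ.≤ w ∸ queuedWeight Q+
      tracked = subst (w′ ∸ suc a ℕ.≤_)
        (trans (∸-∸-comm w (queuedWeight Q) (suc a))
               (trans (ℕ.∸-+-assoc w (suc a) (queuedWeight Q)) (cong (w ∸_) (sym (queuedWeight-enqueue Q j a)))))
        (ℕ.∸-monoˡ-≤ (suc a) (proj₂ (tracks inv)))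

    inGroup-first : ∀ g u Q w′ a → Invariant (state (suc g) (suc u) Q) w′ →
      InGroup (e (optChoice g (suc u)) ∸ 1) (optChoice g (suc u))
              (observe (state (suc g) (suc u) Q) (optChoice g (suc u) , suc a)) (w′ ∸ suc a)
    inGroup-first g u Q w′ a inv rewrite observe-first g u Q a (drained inv) =
      drain-invariant g (u ∸ a) Q (w′ ∸ suc a) (m≤1+n⇒m∸1+k≤n a (proj₁ (tracks inv))) tracked (short inv) ,
      ℕ.≤-trans (ℕ.+-monoˡ-≤ (e j ∸ 1) (drain-shortens g (u ∸ a) Q j))
                (ℕ.≤-reflexive (cong (λ l → length l ℕ.+ (e j ∸ 1)) (drained inv)))
      where
      j : Fin (suc N)
      j = optChoice g (suc u)
      tracked : w′ ∸ suc a ℕ.≤ u ∸ a ∸ queuedWeight Q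
      tracked = subst (w′ ∸ suc a ℕ.≤_) (∸-∸-comm (suc u) (queuedWeight Q) (suc a))
                      (ℕ.∸-monoˡ-≤ (suc a) (proj₂ (tracks inv)))

    1*e≡1+[e∸1] : ∀ j → 1 ℕ.* e j ≡ suc (e j ∸ 1)
    1*e≡1+[e∸1] j = trans (ℕ.*-identityˡ (e j)) (sym (ℕ.suc-pred (e j) {{ℕ.>-nonZero (e≥1 j)}}))

    mutual
      costS-≤ : ∀ f h w′ s → stateAfter h ≡ s → Invariant s w′ →
        costS I e simulating f h w′ ≤ potential s + leftoverCost c e
      costS-≤ zero h w′ s _ inv = potential+leftoverCost-nonneg s (short inv)
      costS-≤ (suc f) h zero s _ inv = potential+leftoverCost-nonneg s (short inv)
      costS-≤ (suc f) h (suc w′) (state zero (suc u) Q) _ inv with () ← proj₁ (tracks inv)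
      costS-≤ (suc f) h (suc w′) (state g zero Q) _ inv
        with () ← ℕ.≤-trans (proj₂ (tracks inv)) (ℕ.≤-reflexive (ℕ.0∸n≡0 (queuedWeight Q)))
      costS-≤ (suc f) h (suc w′) s@(state (suc g) (suc u) Q) after inv = begin
        costS I e simulating (suc f) h (suc w′)
          ≡⟨ costS-decision e simulating f h w′ (cong nextChoice after) ⟩
        group I e simulating f j (1 ℕ.* e j) h (suc w′)
          ≡⟨ cong (λ r → group I e simulating f j r h (suc w′)) (1*e≡1+[e∸1] j) ⟩
        group I e simulating f j (suc (e j ∸ 1)) h (suc w′)
          ≤⟨ insert-≤ s j _ (λ k → group-≤ f j (e j ∸ 1) _ _ _ (after-snoc k)
                                  (inGroup-first g u Q (suc w′) (toℕ k) inv)) ⟩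
        potential s + leftoverCost c e ∎
        where
        open ≤-Reasoning
        j : Fin (suc N)
        j = optChoice g (suc u)
        after-snoc : ∀ k → stateAfter (h ++ (j , wt I k) ∷ []) ≡ observe s (j , wt I k)
        after-snoc k = trans (stateAfter-snoc h _) (cong (λ t → observe t (j , wt I k)) after)

      group-≤ : ∀ f j r h w′ s → stateAfter h ≡ s → InGroup r j s w′ →
        group I e simulating f j r h w′ ≤ potential s + leftoverCost c e
      group-≤ f j zero h w′ s after (inv , _) = costS-≤ f h w′ s after inv
      group-≤ f j (suc r) h w′ s after inGroup = insert-≤ s j _ (λ k →
        group-≤ f j r _ _ _ (trans (stateAfter-snoc h _) (cong (λ t → observe t (j , wt I k)) after))
                (inGroup-observe (toℕ k) inGroup))

    blockCost≤OPT+leftoverCost : blockCost I e simulating ≤ OPT I + leftoverCost c e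
    blockCost≤OPT+leftoverCost = begin
      costS I e simulating W [] W       ≤⟨ costS-≤ W [] W initial refl initial-invariant ⟩
      potential initial + L             ≡⟨ cong (_+ L) (potential-drain W W E) ⟩
      (simCost W W E - queuedCost c E) + L
                                        ≡⟨ cong (λ q → simCost W W E - q + L) (queuedCost-noQueues c) ⟩
      (simCost W W E - 0ℚ) + L          ≡⟨ cong (_+ L) (+-identityʳ (simCost W W E)) ⟩
      simCost W W E + L                 ≤⟨ +-monoˡ-≤ L (simCost≤optF W W E (λ p → Vec.lookup-replicate p [])) ⟩
      OPT I + L                         ∎
      where
      open ≤-Reasoning
      L : ℚ
      L = leftoverCost c e
      E : Queues (suc N)
      E = noQueues (suc N)
      initial-invariant : Invariant initial W
      initial-invariant = drain-invariant W W E W ℕ.≤-refl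
        (ℕ.≤-reflexive (cong (W ∸_) (sym (queuedWeight-noQueues (suc N)))))
        (λ p → subst (λ l → length l ℕ.≤ e p ∸ 1) (sym (Vec.lookup-replicate p [])) ℕ.z≤n)

blockSize≥1 : ∀ {n W} (I : Instance n W) ε e → ValidBlockSizes I ε e → ∀ p → 1 ℕ.≤ e p
blockSize≥1 I ε e valid p = from-dec (θ I ε * T I ≤? Instance.c I p)
  where
  from-dec : Dec (θ I ε * T I ≤ Instance.c I p) → 1 ℕ.≤ e p
  from-dec (yes θT≤c) = ℕ.≤-reflexive (sym (proj₁ (valid p) θT≤c))
  from-dec (no θT≰c) = let (k , e≡2^k , _) = proj₂ (valid p) (≰⇒> θT≰c)
                       in subst (1 ℕ.≤_) (sym e≡2^k) (ℕ.m^n>0 2 k)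

n*2θ≡1/5 : ∀ N ε t → ℕ→ℚ (suc N) * (ℕ→ℚ 2 * ((ε div ℕ→ℚ (10 ℕ.* suc N)) * t)) ≡ (ε * t) div ℕ→ℚ 5
n*2θ≡1/5 N ε t = begin
  n * (ℕ→ℚ 2 * ((ε div q) * t))         ≡⟨ cong (λ z → n * (ℕ→ℚ 2 * (z * t))) (div≡*1/ ε q q≢0) ⟩
  n * (ℕ→ℚ 2 * ((ε * 1/q) * t))         ≡⟨ solve 5 (λ n d ε y t → n :* (d :* ((ε :* y) :* t)) := (ε :* t) :* (d :* (n :* y)))
                                             refl n (ℕ→ℚ 2) ε 1/q t ⟩
  (ε * t) * (ℕ→ℚ 2 * (n * 1/q))         ≡⟨ cong (λ z → (ε * t) * (ℕ→ℚ 2 * z)) n*1/q≡1/10 ⟩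
  (ε * t) * (ℕ→ℚ 2 * 1/10)              ≡⟨ sym (div≡*1/ (ε * t) (ℕ→ℚ 5) (ℕ→ℚ-suc≢0 4)) ⟩
  (ε * t) div ℕ→ℚ 5                     ∎
  where
  open ≡-Reasoning
  n : ℚ
  n = ℕ→ℚ (suc N)
  q : ℚ
  q = ℕ→ℚ (10 ℕ.* suc N)
  q≢0 : q ≢ 0ℚ
  q≢0 = ℕ→ℚ-suc≢0 (N ℕ.+ 9 ℕ.* suc N)
  1/q : ℚ
  1/q = (1/ q) {{≢-nonZero q≢0}}
  1/10 : ℚ
  1/10 = (1/ ℕ→ℚ 10) {{≢-nonZero (ℕ→ℚ-suc≢0 9)}}
  n*1/q≡1/10 : n * 1/q ≡ 1/10
  n*1/q≡1/10 = begin
    n * 1/q                       ≡⟨ sym (*-identityˡ (n * 1/q)) ⟩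
    1ℚ * (n * 1/q)                ≡⟨ cong (_* (n * 1/q)) 1≡1/10*10 ⟩
    1/10 * ℕ→ℚ 10 * (n * 1/q)     ≡⟨ solve 4 (λ t d x y → t :* d :* (x :* y) := t :* ((d :* x) :* y)) refl 1/10 (ℕ→ℚ 10) n 1/q ⟩
    1/10 * ((ℕ→ℚ 10 * n) * 1/q)   ≡⟨ cong (λ z → 1/10 * (z * 1/q)) (sym (ℕ→ℚ-* 10 (suc N))) ⟩
    1/10 * (q * 1/q)              ≡⟨ cong (1/10 *_) (*-inverseʳ q {{≢-nonZero q≢0}}) ⟩
    1/10 * 1ℚ                     ≡⟨ *-identityʳ 1/10 ⟩
    1/10                          ∎
    where
    1≡1/10*10 : 1ℚ ≡ 1/10 * ℕ→ℚ 10
    1≡1/10*10 = refl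

module SlackBound {N W : ℕ} (I : Instance (suc N) W) (V : Valid I) (ε : ℚ) (ε>0 : 0ℚ < ε)
                  (e : Fin (suc N) → ℕ) (valid : ValidBlockSizes I ε e) where
  open ValidInstance I V

  T≥0 : 0ℚ ≤ T I
  T≥0 = *-nonneg (div-nonneg (ℕ→ℚ-nonneg W) (ℕ→ℚ-nonneg 2))
                 (minFin-nonneg _ (λ i → div-nonneg (c≥0 i) (Ebar≥0 i)))
    where
    Ebar≥0 : ∀ i → 0ℚ ≤ Ebar I i
    Ebar≥0 i = sumFin-nonneg (λ k → *-nonneg (proj₁ (proj₂ V) i k) (ℕ→ℚ-nonneg (2 ℕ.^ ⌊log₂ wt I k ⌋)))

  2θT≥0 : 0ℚ ≤ ℕ→ℚ 2 * (θ I ε * T I)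
  2θT≥0 = *-nonneg (ℕ→ℚ-nonneg 2) (*-nonneg (div-nonneg (<⇒≤ ε>0) (ℕ→ℚ-nonneg (10 ℕ.* suc N))) T≥0)

  extra-items-cost : ∀ p → c p * ℕ→ℚ (e p ∸ 1) ≤ ℕ→ℚ 2 * (θ I ε * T I)
  extra-items-cost p = from-dec (θ I ε * T I ≤? c p)
    where
    from-dec : Dec (θ I ε * T I ≤ c p) → c p * ℕ→ℚ (e p ∸ 1) ≤ ℕ→ℚ 2 * (θ I ε * T I)
    from-dec (yes θT≤c) = begin
      c p * ℕ→ℚ (e p ∸ 1)           ≡⟨ cong (λ m → c p * ℕ→ℚ (m ∸ 1)) (proj₁ (valid p) θT≤c) ⟩
      c p * 0ℚ                      ≡⟨ *-zeroʳ (c p) ⟩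
      0ℚ                            ≤⟨ 2θT≥0 ⟩
      ℕ→ℚ 2 * (θ I ε * T I)         ∎
      where open ≤-Reasoning
    from-dec (no θT≰c) = let (_ , _ , _ , ec≤2θT) = proj₂ (valid p) (≰⇒> θT≰c) in begin
      c p * ℕ→ℚ (e p ∸ 1)           ≤⟨ *-monoˡ-≤-nonNeg (c p) {{nonNegative (c≥0 p)}} (ℕ→ℚ-mono (ℕ.m∸n≤m (e p) 1)) ⟩
      c p * ℕ→ℚ (e p)               ≡⟨ *-comm (c p) (ℕ→ℚ (e p)) ⟩
      ℕ→ℚ (e p) * c p               ≤⟨ ec≤2θT ⟩
      ℕ→ℚ 2 * (θ I ε * T I)         ∎
      where open ≤-Reasoning

  leftoverCost≤εT/5 : leftoverCost c e ≤ (ε * T I) div ℕ→ℚ 5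
  leftoverCost≤εT/5 = begin
    leftoverCost c e                     ≤⟨ sumFin-mono {g = λ _ → ℕ→ℚ 2 * (θ I ε * T I)} extra-items-cost ⟩
    sumFin {suc N} (λ _ → ℕ→ℚ 2 * (θ I ε * T I)) ≡⟨ sumFin-const (suc N) (ℕ→ℚ 2 * (θ I ε * T I)) ⟩
    ℕ→ℚ (suc N) * (ℕ→ℚ 2 * (θ I ε * T I)) ≡⟨ n*2θ≡1/5 N ε (T I) ⟩
    (ε * T I) div ℕ→ℚ 5                  ∎
    where open ≤-Reasoning

theorem2 : (n W : ℕ) → 1 ℕ.≤ n → 1 ℕ.≤ W → (ε : ℚ) → 0ℚ < ε → ε < 1ℚ →
    (I : Instance n W) → Valid I → (e : Fin n → ℕ) → ValidBlockSizes I ε e →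
    ((σ : BlockStrategy I) → OPT I ≤ blockCost I e σ)
    × ∃ (λ (σ : BlockStrategy I) → blockCost I e σ ≤ OPT I + (ε * T I) div ℕ→ℚ 5)
theorem2 zero _ () _ _ _ _ _ _ _ _
theorem2 (suc N) W _ _ ε ε>0 _ I V e valid =
  (λ σ → LowerBound.OPT≤blockCost I V e e≥1 σ) ,
  (simulating , ≤-trans blockCost≤OPT+leftoverCost
                          (+-monoʳ-≤ (OPT I) (SlackBound.leftoverCost≤εT/5 I V ε ε>0 e valid)))
  where
  e≥1 : ∀ p → 1 ℕ.≤ e p
  e≥1 = blockSize≥1 I ε e valid
  open Simulation I V
  open Blocks e e≥1
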